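{- Let $k\ge 1$. (i) For every $n\ge 1$, $\chi_{\mu_k}(P_n)=\lceil n/2\rceil$. (ii) For every $n\ge 3$, $\chi_{\mu_k}(C_n)=\lceil n/3\rceil$ if $n\le 3k$, and $\chi_{\mu_k}(C_n)=\lceil n/2\rceil$ otherwise.
   Context: All graphs are finite, simple and undirected; $P_n$ and $C_n$ denote the path and cycle on $n$ vertices. A $u,v$-geodesic is a shortest $u,v$-path. For a positive integer $k$, a set $M\subseteq V(G)$ is a $k$-distance mutual-visibility set if for every two distinct $u,v\in M$ there is a $u,v$-geodesic of length at most $k$ none of whose internal vertices lies in $M$. $\chi_{\mu_k}(G)$ is the minimum number of parts in a partition of $V(G)$ into $k$-distance mutual-visibility sets. -}

module Defs where

open import Data.Nat using (ℕ; zero; suc; _+_; _≤_; _<_)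
open import Data.Nat.DivMod using (_/_)
open import Data.Fin using (Fin; zero; suc; toℕ; fromℕ; inject₁)
open import Data.Product using (Σ; ∃; _×_)
open import Data.Sum using (_⊎_)
open import Relation.Binary.PropositionalEquality using (_≡_; _≢_)
open import Relation.Nullary using (¬_)

record Graph (n : ℕ) : Set₁ where
  field
    Adj : Fin n → Fin n → Set
open Graph public

P : (n : ℕ) → Graph n
P n = record { Adj = λ i j → (toℕ j ≡ suc (toℕ i)) ⊎ (toℕ i ≡ suc (toℕ j)) }

-- The cycle C_n (intended for n ≥ 3): P_n plus the edge {0, n-1}.
C : (n : ℕ) → Graph n
C n = record { Adj = λ i j →
        (toℕ j ≡ suc (toℕ i)) ⊎ (toℕ i ≡ suc (toℕ j))
        ⊎ ((toℕ i ≡ 0) × (suc (toℕ j) ≡ n))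
        ⊎ ((toℕ j ≡ 0) × (suc (toℕ i) ≡ n)) }

record Walk {n : ℕ} (G : Graph n) (u v : Fin n) (m : ℕ) : Set where
  field
    vtx   : Fin (suc m) → Fin n
    start : vtx zero ≡ u
    end   : vtx (fromℕ m) ≡ v
    step  : (i : Fin m) → Adj G (vtx (inject₁ i)) (vtx (suc i))
open Walk public

-- A u,v-geodesic of length m: a u,v-walk of length m such that no
-- u,v-walk is shorter (such a walk is automatically a path).
IsGeodesic : {n : ℕ} (G : Graph n) {u v : Fin n} {m : ℕ} → Walk G u v m → Set
IsGeodesic G {u} {v} {m} w = (m' : ℕ) → m' < m → ¬ Walk G u v m'

InternalAvoids : {n : ℕ} {G : Graph n} {u v : Fin n} {m : ℕ} →
                 (Fin n → Set) → Walk G u v m → Set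
InternalAvoids {m = m} M w =
  (i : Fin (suc m)) → 0 < toℕ i → toℕ i < m → ¬ M (vtx w i)

IsKDistMV : {n : ℕ} (G : Graph n) (k : ℕ) (M : Fin n → Set) → Set
IsKDistMV {n} G k M =
  (u v : Fin n) → M u → M v → u ≢ v →
  Σ ℕ λ m → m ≤ k × Σ (Walk G u v m) λ w → IsGeodesic G w × InternalAvoids M w

-- A partition of V(G) into (at most) t k-distance mutual-visibility sets,
-- given as a colouring whose colour classes are the parts.
KMVColouring : {n : ℕ} (G : Graph n) (k t : ℕ) → Set
KMVColouring {n} G k t =
  Σ (Fin n → Fin t) λ c → (i : Fin t) → IsKDistMV G k (λ v → c v ≡ i)

ChiMuK≡ : {n : ℕ} (G : Graph n) (k t : ℕ) → Set
ChiMuK≡ G k t = KMVColouring G k t × ((t' : ℕ) → KMVColouring G k t' → t ≤ t')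

⌈_/2⌉' : ℕ → ℕ
⌈ n /2⌉' = (n + 1) / 2

⌈_/3⌉' : ℕ → ℕ
⌈ n /3⌉' = (n + 2) / 3

{-# OPTIONS --safe #-}
-- Upper bounds: the colouring x ↦ ⌊x/2⌋ splits P_n and C_n into pairs of adjacent
-- vertices. For n ≤ 3k the colouring x ↦ x mod t with t = ⌈n/3⌉ splits C_n into classes
-- {r, r + t, r + 2t}; any two members are joined by an arc containing no third member
-- whose length is at most t ≤ k and at most n/2, so that the arc is a geodesic.
-- Lower bounds: with fewer colours, pigeonhole gives a colour class with three
-- (P_n, or C_n with n > 3k) or four (C_n) members a < b < c (< d). Along a walk the
-- position of a vertex moves by at most one per step; on C_n this holds for the
-- position lifted to the universal cover, cut open at a vertex the walk avoids. So the
-- geodesic from a to c in P_n meets b; in C_n the one from c to a avoiding b meets d;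
-- and in C_n the three geodesics between a, b, c, each avoiding the third vertex,
-- together wind once around the cycle, whence n ≤ 3k.
module Submission where

open import Defs
open import Data.Nat
  using (ℕ; zero; suc; _+_; _*_; _∸_; _≤_; _<_; _>_; z≤n; s≤s; s≤s⁻¹; _≟_; _≤?_; _<?_; NonZero; >-nonZero; >-nonZero⁻¹)
open import Data.Nat.Properties hiding (<⇒≢)
open import Data.Nat.DivMod
open import Data.Nat.Tactic.RingSolver using (solve-∀)
open import Data.Fin using (Fin; zero; suc; toℕ; fromℕ; fromℕ<; inject₁; opposite)
open import Data.Fin.Patterns using (0F; 1F; 2F; 3F)
open import Data.Fin.Properties
  using (toℕ-injective; toℕ<n; toℕ-fromℕ; toℕ-fromℕ<; toℕ-inject₁; opposite-prop; <⇒≢)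
import Data.Fin as Fin
import Data.Fin.Properties as Fin
open import Data.Vec.Functional using (_∷_)
open import Data.Product using (Σ; ∃; _×_; _,_)
open import Data.Sum using (_⊎_; inj₁; inj₂; [_,_]′)
import Data.Sum as Sum
open import Data.Empty using (⊥; ⊥-elim)
open import Function using (_∘_; id)
open import Relation.Nullary using (¬_; yes; no)
open import Relation.Binary.Definitions using (Symmetric; tri<; tri≈; tri>)
open import Relation.Binary.PropositionalEquality
open import Algebra.Properties.CommutativeMonoid.Sum +-0-commutativeMonoid
  using (sum-syntax; ∑-comm; sum-cong-≗; sum-replicate-zero)

opposite-inject₁ : ∀ {m} (i : Fin m) → opposite (inject₁ i) ≡ suc (opposite i)
opposite-inject₁ zero    = refl
opposite-inject₁ (suc i) = cong inject₁ (opposite-inject₁ i)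

opposite-fromℕ : ∀ m → opposite (fromℕ m) ≡ zero
opposite-fromℕ zero    = refl
opposite-fromℕ (suc m) = cong inject₁ (opposite-fromℕ m)

-- Walks

module _ {n : ℕ} {G : Graph n} where

  walk₀⇒≡ : ∀ {u v} → Walk G u v 0 → u ≡ v
  walk₀⇒≡ w = trans (sym (start w)) (end w)

  first-edge : ∀ {u v m} (w : Walk G u v (suc m)) → Adj G u (vtx w (suc zero))
  first-edge w = subst (λ x → Adj G x (vtx w (suc zero))) (start w) (step w zero)

  tail : ∀ {u v m} (w : Walk G u v (suc m)) → Walk G (vtx w (suc zero)) v m
  tail w = record { vtx = vtx w ∘ suc ; start = refl ; end = end w ; step = step w ∘ suc }

  edge : ∀ {u v} → Adj G u v → Walk G u v 1
  edge {u} {v} uv = record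
    { vtx = λ { zero → u ; (suc zero) → v } ; start = refl ; end = refl ; step = λ { zero → uv } }

  reverse : Symmetric (Adj G) → ∀ {u v m} → Walk G u v m → Walk G v u m
  reverse sym-adj {m = m} w = record
    { vtx   = vtx w ∘ opposite
    ; start = end w
    ; end   = trans (cong (vtx w) (opposite-fromℕ m)) (start w)
    ; step  = λ i → subst (λ j → Adj G (vtx w j) (vtx w (inject₁ (opposite i))))
                          (sym (opposite-inject₁ i)) (sym-adj (step w (opposite i))) }

  reverse-InternalAvoids : ∀ (sym-adj : Symmetric (Adj G)) {M : Fin n → Set} {u v m} (w : Walk G u v m) →
                           InternalAvoids M w → InternalAvoids M (reverse sym-adj w)
  reverse-InternalAvoids sym-adj {m = m} w avoids i 0<i i<m =
    avoids (opposite i) (subst (0 <_) (sym (opposite-prop i)) (m<n⇒0<n∸m i<m))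
                        (subst (_< m) (sym (opposite-prop i)) (∸-monoʳ-< 0<i (<⇒≤ i<m)))

  Avoids : ∀ {u v m} → Fin n → Walk G u v m → Set
  Avoids x w = ∀ i → vtx w i ≢ x

  InternalAvoids⇒Avoids : ∀ (M : Fin n → Set) {u v m x} (w : Walk G u v m) → InternalAvoids M w →
                          M x → x ≢ u → x ≢ v → Avoids x w
  InternalAvoids⇒Avoids M w avoids Mx x≢u x≢v zero wᵢ≡x = x≢u (trans (sym wᵢ≡x) (start w))
  InternalAvoids⇒Avoids M {m = m} w avoids Mx x≢u x≢v (suc i) wᵢ≡x with toℕ (suc i) ≟ m
  ... | yes i≡m = x≢v (trans (sym wᵢ≡x) (trans (cong (vtx w) last) (end w)))
    where
    last : suc i ≡ fromℕ m
    last = toℕ-injective (trans i≡m (sym (toℕ-fromℕ m)))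
  ... | no  i≢m = avoids (suc i) (s≤s z≤n) (≤∧≢⇒< (s≤s⁻¹ (toℕ<n (suc i))) i≢m) (subst M (sym wᵢ≡x) Mx)

  RisesByAtMostOne : ∀ {u v m} → (Fin n → ℕ) → Walk G u v m → Set
  RisesByAtMostOne {m = m} φ w = (i : Fin m) → φ (vtx w (suc i)) ≤ suc (φ (vtx w (inject₁ i)))

  module _ (φ : Fin n → ℕ) where

    first-rise : ∀ {u v m} (w : Walk G u v (suc m)) → RisesByAtMostOne φ w → φ (vtx w (suc zero)) ≤ suc (φ u)
    first-rise w rises = subst (λ x → φ (vtx w (suc zero)) ≤ suc (φ x)) (start w) (rises zero)

    rise-≤-length : ∀ {u v} m (w : Walk G u v m) → RisesByAtMostOne φ w → φ v ≤ m + φ u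
    rise-≤-length zero w rises = ≤-reflexive (cong φ (sym (walk₀⇒≡ w)))
    rise-≤-length {u} {v} (suc m) w rises = begin
      φ v                       ≤⟨ rise-≤-length m (tail w) (rises ∘ suc) ⟩
      m + φ (vtx w (suc zero))  ≤⟨ +-monoʳ-≤ m (first-rise w rises) ⟩
      m + suc (φ u)             ≡⟨ +-suc m (φ u) ⟩
      suc m + φ u               ∎
      where open ≤-Reasoning

    intermediate-value : ∀ {u v} m (w : Walk G u v m) → RisesByAtMostOne φ w →
                         ∀ s → φ u ≤ s → s ≤ φ v → ∃ λ i → φ (vtx w i) ≡ s
    intermediate-value zero w rises s φu≤s s≤φv =
      zero , trans (cong φ (start w)) (≤-antisym φu≤s (subst (λ x → s ≤ φ x) (sym (walk₀⇒≡ w)) s≤φv))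
    intermediate-value {u} (suc m) w rises s φu≤s s≤φv with φ u ≟ s
    ... | yes φu≡s = zero , trans (cong φ (start w)) φu≡s
    ... | no  φu≢s = let i , φwᵢ≡s = intermediate-value m (tail w) (rises ∘ suc) s
                                       (≤-trans (first-rise w rises) (≤∧≢⇒< φu≤s φu≢s)) s≤φv
                     in suc i , φwᵢ≡s

    cannot-jump-over : ∀ (M : Fin n → Set) {u v x m} (w : Walk G u v m) → InternalAvoids M w →
                       RisesByAtMostOne φ w → (∀ y → φ y ≡ φ x → y ≡ x) →
                       M x → x ≢ u → x ≢ v → φ u ≤ φ x → φ x ≤ φ v → ⊥
    cannot-jump-over M {x = x} {m} w avoids rises φ-level-x Mx x≢u x≢v φu≤φx φx≤φv =
      let i , φwᵢ≡φx = intermediate-value m w rises (φ x) φu≤φx φx≤φv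
      in InternalAvoids⇒Avoids M w avoids Mx x≢u x≢v i (φ-level-x (vtx w i) φwᵢ≡φx)

-- Mutual visibility

Visible : ∀ {n} (G : Graph n) → ℕ → (Fin n → Set) → Fin n → Fin n → Set
Visible G k M u v = Σ ℕ λ m → m ≤ k × Σ (Walk G u v m) λ w → IsGeodesic G w × InternalAvoids M w

module _ {n : ℕ} {G : Graph n} {k : ℕ} {M : Fin n → Set} where

  Visible-sym : Symmetric (Adj G) → ∀ {u v} → Visible G k M u v → Visible G k M v u
  Visible-sym sym-adj (m , m≤k , w , geodesic , avoids) =
    m , m≤k , reverse sym-adj w , (λ l l<m w′ → geodesic l l<m (reverse sym-adj w′)) ,
    reverse-InternalAvoids sym-adj {M} w avoids

  adjacent⇒Visible : 1 ≤ k → ∀ {u v} → u ≢ v → Adj G u v → Visible G k M u v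
  adjacent⇒Visible 1≤k {u} {v} u≢v uv = 1 , 1≤k , uv-edge , shortest , no-internal
    where
    uv-edge : Walk G u v 1
    uv-edge = edge uv
    shortest : IsGeodesic G uv-edge
    shortest zero    _        w = u≢v (walk₀⇒≡ w)
    shortest (suc _) (s≤s ()) _
    no-internal : InternalAvoids M uv-edge
    no-internal zero       ()
    no-internal (suc zero) _ (s≤s ())

  ordered⇒IsKDistMV : Symmetric (Adj G) →
                      (∀ u v → M u → M v → u Fin.< v → Visible G k M u v ⊎ Visible G k M v u) →
                      IsKDistMV G k M
  ordered⇒IsKDistMV sym-adj visible u v Mu Mv u≢v with Fin.<-cmp u v
  ... | tri< u<v _ _ = [ id , Visible-sym sym-adj ]′ (visible u v Mu Mv u<v)
  ... | tri≈ _ u≡v _ = ⊥-elim (u≢v u≡v)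
  ... | tri> _ _ v<u = [ Visible-sym sym-adj , id ]′ (visible v u Mv Mu v<u)

module _ {n t : ℕ} (h : Fin n → ℕ) (h<t : ∀ x → h x < t) where

  colourBy : Fin n → Fin t
  colourBy x = fromℕ< (h<t x)

  colourBy-≡ : ∀ {x y} → colourBy x ≡ colourBy y → h x ≡ h y
  colourBy-≡ {x} {y} cx≡cy = trans (sym (toℕ-fromℕ< (h<t x))) (trans (cong toℕ cx≡cy) (toℕ-fromℕ< (h<t y)))

same-half⇒consecutive : ∀ a b → a / 2 ≡ b / 2 → a < b → b ≡ suc a
same-half⇒consecutive a b a/2≡b/2 a<b = ≤-antisym (begin
  b                    ≡⟨ m≡m%n+[m/n]*n b 2 ⟩
  b % 2 + (b / 2) * 2  ≤⟨ +-mono-≤ (s≤s⁻¹ (m%n<n b 2)) (≤-reflexive (cong (_* 2) (sym a/2≡b/2))) ⟩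
  1 + (a / 2) * 2      ≤⟨ s≤s (m/n*n≤m a 2) ⟩
  suc a                ∎) a<b
  where open ≤-Reasoning

halvesColouring : ∀ {n} (G : Graph n) k t → Symmetric (Adj G) →
                  (∀ {x y} → toℕ y ≡ suc (toℕ x) → Adj G x y) → 1 ≤ k → n ≤ t * 2 → KMVColouring G k t
halvesColouring {n} G k t sym-adj successor-adj 1≤k n≤2t = colour , λ j → ordered⇒IsKDistMV sym-adj (pairs j)
  where
  half<t : (x : Fin n) → toℕ x / 2 < t
  half<t x = m<n*o⇒m/o<n (≤-trans (toℕ<n x) n≤2t)
  colour : Fin n → Fin t
  colour = colourBy (λ x → toℕ x / 2) half<t
  pairs : ∀ j u v → colour u ≡ j → colour v ≡ j → u Fin.< v →
          Visible G k (λ x → colour x ≡ j) u v ⊎ Visible G k (λ x → colour x ≡ j) v u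
  pairs j u v u∈j v∈j u<v = inj₁ (adjacent⇒Visible {M = λ x → colour x ≡ j} 1≤k (<⇒≢ u<v)
    (successor-adj (same-half⇒consecutive _ _ (colourBy-≡ _ half<t {u} {v} (trans u∈j (sym v∈j))) u<v)))

-- Counting colour classes

δ : ∀ {m} → Fin m → Fin m → ℕ
δ zero    zero    = 1
δ zero    (suc _) = 0
δ (suc _) zero    = 0
δ (suc a) (suc b) = δ a b

δ-refl : ∀ {m} (a : Fin m) → δ a a ≡ 1
δ-refl zero    = refl
δ-refl (suc a) = δ-refl a

δ-≢ : ∀ {m} {a b : Fin m} → a ≢ b → δ a b ≡ 0
δ-≢ {a = zero}  {zero}  a≢b = ⊥-elim (a≢b refl)
δ-≢ {a = zero}  {suc b} a≢b = refl
δ-≢ {a = suc a} {zero}  a≢b = refl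
δ-≢ {a = suc a} {suc b} a≢b = δ-≢ (a≢b ∘ cong suc)

∑-δ : ∀ {m} (a : Fin m) → ∑[ b < m ] δ a b ≡ 1
∑-δ {suc m} zero    = cong suc (sum-replicate-zero m)
∑-δ {suc m} (suc a) = ∑-δ a

∑-1 : ∀ n → ∑[ x < n ] 1 ≡ n
∑-1 zero    = refl
∑-1 (suc n) = cong suc (∑-1 n)

∑-pigeonhole : ∀ {m} d (h : Fin m → ℕ) → m * d < ∑[ j < m ] h j → ∃ λ j → d < h j
∑-pigeonhole {suc m} d h m*d<∑h with d <? h zero
... | yes d<h₀ = zero , d<h₀
... | no  d≮h₀ = let j , d<hⱼ = ∑-pigeonhole d (h ∘ suc)
                                  (+-cancelˡ-< d _ _ (≤-trans m*d<∑h (+-monoˡ-≤ _ (≮⇒≥ d≮h₀))))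
                 in suc j , d<hⱼ

module _ {n m : ℕ} (f : Fin n → Fin m) where

  fibreSize : Fin m → ℕ
  fibreSize j = ∑[ x < n ] δ (f x) j

  ∑-fibreSize : ∑[ j < m ] fibreSize j ≡ n
  ∑-fibreSize = begin
    ∑[ j < m ] ∑[ x < n ] δ (f x) j  ≡⟨ ∑-comm (λ j x → δ (f x) j) ⟩
    ∑[ x < n ] ∑[ j < m ] δ (f x) j  ≡⟨ sum-cong-≗ (∑-δ ∘ f) ⟩
    ∑[ x < n ] 1                     ≡⟨ ∑-1 n ⟩
    n                                ∎
    where open ≡-Reasoning

Increasing : ∀ {n l} → (Fin (suc l) → Fin n) → Set
Increasing {l = l} g = (i : Fin l) → g (inject₁ i) Fin.< g (suc i)

FibreChain : ∀ {n m} → (Fin n → Fin m) → Fin m → ℕ → Set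
FibreChain {n} f j l = Σ (Fin (suc l) → Fin n) λ g → Increasing g × (∀ i → f (g i) ≡ j)

module _ {n m : ℕ} (f : Fin (suc n) → Fin m) where

  FibreChain-suc : ∀ {j l} → FibreChain (f ∘ suc) j l → FibreChain f j l
  FibreChain-suc (g , increasing , inFibre) = suc ∘ g , s≤s ∘ increasing , inFibre

  FibreChain-cons : ∀ {l} → FibreChain (f ∘ suc) (f zero) l → FibreChain f (f zero) (suc l)
  FibreChain-cons (g , increasing , inFibre) = (zero ∷ suc ∘ g) , increasing′ , inFibre′
    where
    increasing′ : Increasing (zero ∷ suc ∘ g)
    increasing′ zero    = s≤s z≤n
    increasing′ (suc i) = s≤s (increasing i)
    inFibre′ : ∀ i → f ((zero ∷ suc ∘ g) i) ≡ f zero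
    inFibre′ zero    = refl
    inFibre′ (suc i) = inFibre i

fibre-chain : ∀ {n m} (f : Fin n → Fin m) j l → l < fibreSize f j → FibreChain f j l
fibre-chain {suc n} f j l l<size with f zero Fin.≟ j
... | no f₀≢j = FibreChain-suc f (fibre-chain (f ∘ suc) j l
                  (subst (λ d → l < d + fibreSize (f ∘ suc) j) (δ-≢ f₀≢j) l<size))
... | yes refl with l | subst (λ d → l < d + fibreSize (f ∘ suc) (f zero)) (δ-refl (f zero)) l<size
...   | zero  | _         = (λ _ → zero) , (λ ()) , (λ _ → refl)
...   | suc l | l<1+size  = FibreChain-cons f (fibre-chain (f ∘ suc) (f zero) l (s≤s⁻¹ l<1+size))

colour-class-chain : ∀ {n t} l (c : Fin n → Fin t) → t * l < n → ∃ λ j → FibreChain c j l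
colour-class-chain {t = t} l c t*l<n =
  let j , l<size = ∑-pigeonhole l (fibreSize c) (subst (t * l <_) (sym (∑-fibreSize c)) t*l<n)
  in j , fibre-chain c j l l<size

-- Paths

P-symmetric : ∀ {n} → Symmetric (Adj (P n))
P-symmetric (inj₁ y≡1+x) = inj₂ y≡1+x
P-symmetric (inj₂ x≡1+y) = inj₁ x≡1+y

toℕ-rises-along-P : ∀ {n} {x y : Fin n} → Adj (P n) x y → toℕ y ≤ suc (toℕ x)
toℕ-rises-along-P (inj₁ y≡1+x) = ≤-reflexive y≡1+x
toℕ-rises-along-P (inj₂ x≡1+y) = ≤-trans (n≤1+n _) (≤-trans (≤-reflexive (sym x≡1+y)) (n≤1+n _))

P-lower-bound : ∀ {n k t} → KMVColouring (P n) k t → n ≤ t * 2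
P-lower-bound {n} {k} {t} (col , classes) = ≮⇒≥ no-three-in-a-class
  where
  no-three-in-a-class : t * 2 < n → ⊥
  no-three-in-a-class t*2<n with colour-class-chain 2 col t*2<n
  ... | j , g , increasing , inClass =
    let _ , _ , w , _ , avoids = classes j a c (inClass 0F) (inClass 2F) (<⇒≢ a<c)
    in cannot-jump-over toℕ (λ x → col x ≡ j) w avoids (toℕ-rises-along-P ∘ step w) (λ _ → toℕ-injective)
                        (inClass 1F) (≢-sym (<⇒≢ a<b)) (<⇒≢ b<c) (<⇒≤ a<b) (<⇒≤ b<c)
    where
    a = g 0F; b = g 1F; c = g 2F
    a<b = increasing 0F; b<c = increasing 1F
    a<c = <-trans a<b b<c

-- Cycles

C-symmetric : ∀ {n} → Symmetric (Adj (C n))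
C-symmetric (inj₁ y≡1+x)               = inj₂ (inj₁ y≡1+x)
C-symmetric (inj₂ (inj₁ x≡1+y))        = inj₁ x≡1+y
C-symmetric (inj₂ (inj₂ (inj₁ wraps))) = inj₂ (inj₂ (inj₂ wraps))
C-symmetric (inj₂ (inj₂ (inj₂ wraps))) = inj₂ (inj₂ (inj₁ wraps))

-- Adj (C n) x y unfolds to CycleAdj n (toℕ x) (toℕ y); on ℕ the equations can be matched with refl.
CycleAdj : ℕ → ℕ → ℕ → Set
CycleAdj n i j = (j ≡ suc i) ⊎ (i ≡ suc j) ⊎ ((i ≡ 0) × (suc j ≡ n)) ⊎ ((j ≡ 0) × (suc i ≡ n))

module _ (n c : ℕ) where

  -- The representative of i in the window (c, c + n] of the universal cover of C_n.
  liftℕ : ℕ → ℕ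
  liftℕ i with i ≤? c
  ... | yes _ = i + n
  ... | no  _ = i

  lift-≤ : ∀ {i} → i ≤ c → liftℕ i ≡ i + n
  lift-≤ {i} i≤c with i ≤? c
  ... | yes _   = refl
  ... | no  i≰c = ⊥-elim (i≰c i≤c)

  lift-> : ∀ {i} → c < i → liftℕ i ≡ i
  lift-> {i} c<i with i ≤? c
  ... | yes i≤c = ⊥-elim (<⇒≱ c<i i≤c)
  ... | no  _   = refl

  ≤-lift : ∀ i → i ≤ liftℕ i
  ≤-lift i with i ≤? c
  ... | yes _ = m≤m+n i n
  ... | no  _ = ≤-refl

  lift-step : c < n → ∀ {i j} → CycleAdj n i j → i ≢ c → j ≢ c → liftℕ j ≤ suc (liftℕ i)
  lift-step c<n {i} (inj₁ refl) i≢c j≢c with ≤-<-connex (suc i) c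
  ... | inj₁ j≤c rewrite lift-≤ j≤c | lift-≤ (≤-trans (n≤1+n i) j≤c) = ≤-refl
  ... | inj₂ c<j rewrite lift-> c<j = s≤s (≤-lift i)
  lift-step c<n {j = j} (inj₂ (inj₁ refl)) i≢c j≢c with ≤-<-connex j c | ≤-<-connex (suc j) c
  ... | inj₁ j≤c | inj₁ i≤c rewrite lift-≤ j≤c | lift-≤ i≤c = ≤-trans (n≤1+n _) (n≤1+n _)
  ... | inj₁ j≤c | inj₂ c<i = ⊥-elim (j≢c (≤-antisym j≤c (s≤s⁻¹ c<i)))
  ... | inj₂ c<j | _ rewrite lift-> c<j = ≤-trans (n≤1+n j) (≤-trans (≤-lift (suc j)) (n≤1+n _))
  lift-step c<n {j = j} (inj₂ (inj₂ (inj₁ (refl , 1+j≡n)))) i≢c j≢c with ≤-<-connex j c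
  ... | inj₁ j≤c = ⊥-elim (j≢c (≤-antisym j≤c (s≤s⁻¹ (subst (c <_) (sym 1+j≡n) c<n))))
  ... | inj₂ c<j rewrite lift-> c<j | lift-≤ {0} z≤n =
    ≤-trans (n≤1+n j) (≤-trans (≤-reflexive 1+j≡n) (n≤1+n n))
  lift-step c<n {i} (inj₂ (inj₂ (inj₂ (refl , 1+i≡n)))) i≢c j≢c with ≤-<-connex i c
  ... | inj₁ i≤c = ⊥-elim (i≢c (≤-antisym i≤c (s≤s⁻¹ (subst (c <_) (sym 1+i≡n) c<n))))
  ... | inj₂ c<i rewrite lift-> c<i | lift-≤ {0} z≤n = ≤-reflexive (sym 1+i≡n)

  lift-adjacent-to-cut : ∀ {i} → CycleAdj n i c → i ≢ c → liftℕ i ≤ suc c ⊎ c + n ≤ suc (liftℕ i)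
  lift-adjacent-to-cut {i} (inj₁ refl) i≢c rewrite lift-≤ (n≤1+n i) = inj₂ ≤-refl
  lift-adjacent-to-cut (inj₂ (inj₁ refl)) i≢c rewrite lift-> (n<1+n c) = inj₁ ≤-refl
  lift-adjacent-to-cut (inj₂ (inj₂ (inj₁ (refl , 1+c≡n)))) i≢c rewrite lift-≤ {0} z≤n =
    inj₁ (≤-reflexive (sym 1+c≡n))
  lift-adjacent-to-cut (inj₂ (inj₂ (inj₂ (refl , 1+i≡n)))) i≢c rewrite lift-> (n≢0⇒n>0 i≢c) =
    inj₂ (≤-reflexive (sym 1+i≡n))

lift : ∀ {n} → Fin n → Fin n → ℕ
lift {n} c x = liftℕ n (toℕ c) (toℕ x)

module _ {n : ℕ} where

  lift-injective : ∀ (c : Fin n) {x y} → lift c x ≡ lift c y → x ≡ y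
  lift-injective c {x} {y} eq = toℕ-injective (cases (≤-<-connex (toℕ x) (toℕ c)) (≤-<-connex (toℕ y) (toℕ c)))
    where
    across : ∀ {a b : Fin n} → toℕ a ≤ toℕ c → toℕ c < toℕ b → lift c a ≢ lift c b
    across {a} {b} a≤c c<b eq = <⇒≱ (toℕ<n b)
      (subst (n ≤_) (trans (sym (lift-≤ n _ a≤c)) (trans eq (lift-> n _ c<b))) (m≤n+m n (toℕ a)))
    cases : toℕ x ≤ toℕ c ⊎ toℕ c < toℕ x → toℕ y ≤ toℕ c ⊎ toℕ c < toℕ y → toℕ x ≡ toℕ y
    cases (inj₁ x≤c) (inj₁ y≤c) = +-cancelʳ-≡ n _ _ (trans (sym (lift-≤ n _ x≤c)) (trans eq (lift-≤ n _ y≤c)))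
    cases (inj₂ c<x) (inj₂ c<y) = trans (sym (lift-> n _ c<x)) (trans eq (lift-> n _ c<y))
    cases (inj₁ x≤c) (inj₂ c<y) = ⊥-elim (across x≤c c<y eq)
    cases (inj₂ c<x) (inj₁ y≤c) = ⊥-elim (across y≤c c<x (sym eq))

  lift-rises : ∀ (c : Fin n) {u v m} (w : Walk (C n) u v m) → Avoids c w → RisesByAtMostOne (lift c) w
  lift-rises c w avoids i =
    lift-step n (toℕ c) (toℕ<n c) (step w i) (avoids _ ∘ toℕ-injective) (avoids _ ∘ toℕ-injective)

  -- lift v x ∸ toℕ v and n minus it are the lengths of the two arcs between x and v.
  walk-length-bound : ∀ {x v} m (w : Walk (C n) x v m) → x ≢ v →
                      lift v x ≤ toℕ v + m ⊎ toℕ v + n ≤ lift v x + m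
  walk-length-bound zero w x≢v = ⊥-elim (x≢v (walk₀⇒≡ w))
  walk-length-bound {x} {v} (suc m) w x≢v with vtx w (suc zero) Fin.≟ v
  ... | yes w₁≡v = Sum.map (widen (toℕ v)) (widen (lift v x))
                     (lift-adjacent-to-cut n (toℕ v) (subst (Adj (C n) x) w₁≡v (first-edge w)) (x≢v ∘ toℕ-injective))
    where
    widen : ∀ {a} b → a ≤ suc b → a ≤ b + suc m
    widen b a≤1+b = ≤-trans a≤1+b (≤-trans (s≤s (m≤m+n b m)) (≤-reflexive (sym (+-suc b m))))
  ... | no w₁≢v = Sum.map
      (λ x≤v+m → ≤-trans back (≤-trans (s≤s x≤v+m) (≤-reflexive (sym (+-suc (toℕ v) m)))))
      (λ v+n≤w₁+m → ≤-trans v+n≤w₁+m (≤-trans (+-monoˡ-≤ m forth) (≤-reflexive (sym (+-suc (lift v x) m)))))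
      (walk-length-bound m (tail w) w₁≢v)
    where
    forth : lift v (vtx w (suc zero)) ≤ suc (lift v x)
    forth = lift-step n (toℕ v) (toℕ<n v) (first-edge w) (x≢v ∘ toℕ-injective) (w₁≢v ∘ toℕ-injective)
    back : lift v x ≤ suc (lift v (vtx w (suc zero)))
    back = lift-step n (toℕ v) (toℕ<n v) (C-symmetric (first-edge w)) (w₁≢v ∘ toℕ-injective) (x≢v ∘ toℕ-injective)

  module _ {k : ℕ} {M : Fin n → Set} (visible : IsKDistMV (C n) k M) {x y z : Fin n}
           (Mx : M x) (My : M y) (Mz : M z) (x≢y : x ≢ y) (z≢x : z ≢ x) (z≢y : z ≢ y) where

    detour-length : lift z y ≤ k + lift z x
    detour-length =
      let m , m≤k , w , _ , avoids = visible x y Mx My x≢y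
      in ≤-trans (rise-≤-length (lift z) m w (lift-rises z w (InternalAvoids⇒Avoids M w avoids Mz z≢x z≢y)))
                 (+-monoˡ-≤ _ m≤k)

    no-member-between : ∀ {d} → M d → d ≢ x → d ≢ y → lift z x ≤ lift z d → lift z d ≤ lift z y → ⊥
    no-member-between Md d≢x d≢y =
      let m , _ , w , _ , avoids = visible x y Mx My x≢y
      in cannot-jump-over (lift z) M w avoids (lift-rises z w (InternalAvoids⇒Avoids M w avoids Mz z≢x z≢y))
                          (λ _ → lift-injective z) Md d≢x d≢y

C-lower-bound : ∀ {n k t} → KMVColouring (C n) k t → n ≤ t * 3
C-lower-bound {n} {k} {t} (col , classes) = ≮⇒≥ no-four-in-a-class
  where
  no-four-in-a-class : t * 3 < n → ⊥
  no-four-in-a-class t*3<n with colour-class-chain 3 col t*3<n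
  ... | j , g , increasing , inClass =
    no-member-between (classes j) (inClass 2F) (inClass 0F) (inClass 1F)
      (≢-sym (<⇒≢ a<c)) (<⇒≢ b<c) (≢-sym (<⇒≢ a<b))
      (inClass 3F) (≢-sym (<⇒≢ c<d)) (≢-sym (<⇒≢ a<d))
      (begin lift b c ≡⟨ lift-> n _ b<c ⟩ toℕ c ≤⟨ <⇒≤ c<d ⟩ toℕ d ≡⟨ lift-> n _ b<d ⟨ lift b d ∎)
      (begin lift b d ≡⟨ lift-> n _ b<d ⟩ toℕ d ≤⟨ <⇒≤ (toℕ<n d) ⟩ n ≤⟨ m≤n+m n _ ⟩
             toℕ a + n ≡⟨ lift-≤ n _ (<⇒≤ a<b) ⟨ lift b a ∎)
    where
    open ≤-Reasoning
    a = g 0F; b = g 1F; c = g 2F; d = g 3F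
    a<b = increasing 0F; b<c = increasing 1F; c<d = increasing 2F
    a<c = <-trans a<b b<c; b<d = <-trans b<c c<d; a<d = <-trans a<c c<d

three-arcs : ∀ a b c n k → b + n ≤ k + (a + n) → c ≤ k + b → a + n ≤ k + c → n ≤ 3 * k
three-arcs a b c n k b+n≤k+a+n c≤k+b a+n≤k+c = +-cancelˡ-≤ a _ _ (begin
  a + n              ≤⟨ a+n≤k+c ⟩
  k + c              ≤⟨ +-monoʳ-≤ k c≤k+b ⟩
  k + (k + b)        ≤⟨ +-monoʳ-≤ k (+-monoʳ-≤ k b≤k+a) ⟩
  k + (k + (k + a))  ≡⟨ regroup a k ⟩
  a + 3 * k          ∎)
  where
  open ≤-Reasoning
  regroup : ∀ a k → k + (k + (k + a)) ≡ a + 3 * k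
  regroup = solve-∀
  b≤k+a : b ≤ k + a
  b≤k+a = +-cancelʳ-≤ n _ _ (≤-trans b+n≤k+a+n (≤-reflexive (sym (+-assoc k a n))))

C-large-lower-bound : ∀ {n k t} → KMVColouring (C n) k t → 3 * k < n → n ≤ t * 2
C-large-lower-bound {n} {k} {t} (col , classes) 3k<n = ≮⇒≥ no-three-in-a-class
  where
  no-three-in-a-class : t * 2 < n → ⊥
  no-three-in-a-class t*2<n with colour-class-chain 2 col t*2<n
  ... | j , g , increasing , inClass = <⇒≱ 3k<n (three-arcs (toℕ a) (toℕ b) (toℕ c) n k
      (subst₂ (λ y x → y ≤ k + x) (lift-≤ n _ (<⇒≤ b<c)) (lift-≤ n _ (<⇒≤ a<c))
        (detour-length (classes j) (inClass 0F) (inClass 1F) (inClass 2F) a≢b c≢a c≢b))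
      (subst₂ (λ y x → y ≤ k + x) (lift-> n _ a<c) (lift-> n _ a<b)
        (detour-length (classes j) (inClass 1F) (inClass 2F) (inClass 0F) b≢c a≢b a≢c))
      (subst₂ (λ y x → y ≤ k + x) (lift-≤ n _ (<⇒≤ a<b)) (lift-> n _ b<c)
        (detour-length (classes j) (inClass 2F) (inClass 0F) (inClass 1F) c≢a b≢c (≢-sym a≢b))))
    where
    a = g 0F; b = g 1F; c = g 2F
    a<b = increasing 0F; b<c = increasing 1F
    a<c = <-trans a<b b<c
    a≢b = <⇒≢ a<b; b≢c = <⇒≢ b<c; a≢c = <⇒≢ a<c
    c≢a = ≢-sym a≢c; c≢b = ≢-sym b≢c

-- Clockwise arcs

module _ (n : ℕ) .{{_ : NonZero n}} where

  %-wrap : ∀ {a} → n ≤ a → a < n + n → a % n + n ≡ a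
  %-wrap {a} n≤a a<2n = begin
    a % n + n        ≡⟨ cong (_+ n) (sym (m≤n⇒[n∸m]%m≡n%m n≤a)) ⟩
    (a ∸ n) % n + n  ≡⟨ cong (_+ n) (m<n⇒m%n≡m a∸n<n) ⟩
    a ∸ n + n        ≡⟨ m∸n+n≡m n≤a ⟩
    a                ∎
    where
    open ≡-Reasoning
    a∸n<n : a ∸ n < n
    a∸n<n = +-cancelʳ-< n _ _ (subst (_< n + n) (sym (m∸n+n≡m n≤a)) a<2n)

  suc-% : ∀ a → suc (a % n) % n ≡ suc a % n
  suc-% a = begin
    (1 + a % n) % n          ≡⟨ %-distribˡ-+ 1 (a % n) n ⟩
    (1 % n + a % n % n) % n  ≡⟨ cong (λ r → (1 % n + r) % n) (m%n%n≡m%n a n) ⟩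
    (1 % n + a % n) % n      ≡⟨ %-distribˡ-+ 1 a n ⟨
    (1 + a) % n              ∎
    where open ≡-Reasoning

  %-adjacent : ∀ a → CycleAdj n (a % n) (suc a % n)
  %-adjacent a with suc (a % n) <? n
  ... | yes 1+r<n = inj₁ (trans (sym (suc-% a)) (m<n⇒m%n≡m 1+r<n))
  ... | no  1+r≮n = inj₂ (inj₂ (inj₂ (trans (sym (suc-% a)) (trans (cong (_% n) 1+r≡n) (n%n≡0 n)) , 1+r≡n)))
    where
    1+r≡n : suc (a % n) ≡ n
    1+r≡n = ≤-antisym (m%n<n a n) (≮⇒≥ 1+r≮n)

module _ {n : ℕ} .{{_ : NonZero n}} where

  rotate : Fin n → ℕ → Fin n
  rotate u j = fromℕ< (m%n<n (toℕ u + j) n)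

  rotate-< : ∀ u {j} → toℕ u + j < n → toℕ (rotate u j) ≡ toℕ u + j
  rotate-< u u+j<n = trans (toℕ-fromℕ< _) (m<n⇒m%n≡m u+j<n)

  rotate-≥ : ∀ u {j} → n ≤ toℕ u + j → j < n → toℕ (rotate u j) + n ≡ toℕ u + j
  rotate-≥ u n≤u+j j<n = trans (cong (_+ n) (toℕ-fromℕ< _)) (%-wrap n n≤u+j (+-mono-< (toℕ<n u) j<n))

  clockwise : ∀ u L → Walk (C n) u (rotate u L) L
  clockwise u L = record
    { vtx   = rotate u ∘ toℕ
    ; start = toℕ-injective (trans (rotate-< u (subst (_< n) (sym (+-identityʳ (toℕ u))) (toℕ<n u)))
                                   (+-identityʳ (toℕ u)))
    ; end   = cong (rotate u) (toℕ-fromℕ L)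
    ; step  = λ i → subst₂ (CycleAdj n)
                      (sym (trans (toℕ-fromℕ< _) (cong (λ j → (toℕ u + j) % n) (toℕ-inject₁ i))))
                      (sym (trans (toℕ-fromℕ< _) (cong (_% n) (+-suc (toℕ u) (toℕ i)))))
                      (%-adjacent n (toℕ u + toℕ i)) }

  lift-rotate : ∀ u L → L < n → lift (rotate u L) u + L ≡ toℕ (rotate u L) + n
  lift-rotate u L L<n with toℕ u + L <? n
  ... | yes u+L<n = begin
      lift v u + L      ≡⟨ cong (_+ L) (lift-≤ n _ (≤-trans (m≤m+n (toℕ u) L) (≤-reflexive (sym (rotate-< u u+L<n))))) ⟩
      toℕ u + n + L     ≡⟨ +-assoc (toℕ u) n L ⟩
      toℕ u + (n + L)   ≡⟨ cong (toℕ u +_) (+-comm n L) ⟩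
      toℕ u + (L + n)   ≡⟨ +-assoc (toℕ u) L n ⟨
      toℕ u + L + n     ≡⟨ cong (_+ n) (rotate-< u u+L<n) ⟨
      toℕ v + n         ∎
    where
    open ≡-Reasoning
    v = rotate u L
  ... | no u+L≮n = trans (cong (_+ L) (lift-> n _ v<u)) (sym v+n≡u+L)
    where
    v = rotate u L
    v+n≡u+L : toℕ v + n ≡ toℕ u + L
    v+n≡u+L = rotate-≥ u (≮⇒≥ u+L≮n) L<n
    v<u : toℕ v < toℕ u
    v<u = +-cancelʳ-< n _ _ (subst (_< toℕ u + n) (sym v+n≡u+L) (+-monoʳ-< (toℕ u) L<n))

  clockwise-geodesic : ∀ u L → 0 < L → L + L ≤ n → IsGeodesic (C n) (clockwise u L)
  clockwise-geodesic u L 0<L 2L≤n m m<L w = [ too-short-forwards , too-short-backwards ]′ (walk-length-bound m w u≢v)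
    where
    open ≤-Reasoning
    v = rotate u L
    h+L≡v+n : lift v u + L ≡ toℕ v + n
    h+L≡v+n = lift-rotate u L (<-≤-trans (m<m+n L 0<L) 2L≤n)
    u≢v : u ≢ v
    u≢v u≡v = <⇒≱ 0<L (≤-reflexive (+-cancelˡ-≡ (toℕ v + n) L 0 (begin-equality
      toℕ v + n + L  ≡⟨ cong (_+ L) (lift-≤ n _ ≤-refl) ⟨
      lift v v + L   ≡⟨ cong (λ x → lift v x + L) u≡v ⟨
      lift v u + L   ≡⟨ h+L≡v+n ⟩
      toℕ v + n      ≡⟨ +-identityʳ _ ⟨
      toℕ v + n + 0  ∎)))
    too-short-forwards : lift v u ≤ toℕ v + m → ⊥
    too-short-forwards h≤v+m = <⇒≱ (≤-trans (+-monoʳ-< L m<L) 2L≤n) (+-cancelˡ-≤ (toℕ v) _ _ (begin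
      toℕ v + n        ≡⟨ h+L≡v+n ⟨
      lift v u + L     ≤⟨ +-monoˡ-≤ L h≤v+m ⟩
      toℕ v + m + L    ≡⟨ +-assoc (toℕ v) m L ⟩
      toℕ v + (m + L)  ≡⟨ cong (toℕ v +_) (+-comm m L) ⟩
      toℕ v + (L + m)  ∎))
    too-short-backwards : toℕ v + n ≤ lift v u + m → ⊥
    too-short-backwards v+n≤h+m = <⇒≱ m<L (+-cancelˡ-≤ (lift v u) _ _ (≤-trans (≤-reflexive h+L≡v+n) v+n≤h+m))

  clockwise-Visible : ∀ {k M} u {v} L → rotate u L ≡ v → 0 < L → L + L ≤ n → L ≤ k →
                      (∀ j → 0 < j → j < L → ¬ M (rotate u j)) → Visible (C n) k M u v
  clockwise-Visible u L refl 0<L 2L≤n L≤k avoids =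
    L , L≤k , clockwise u L , clockwise-geodesic u L 0<L 2L≤n , λ i → avoids (toℕ i)

-- Colouring by residues

module _ (t : ℕ) .{{_ : NonZero t}} where

  same-residue-gap : ∀ {a b} → a % t ≡ b % t → a < b → a + t ≤ b
  same-residue-gap {a} {b} a≡b a<b with b / t ≤? a / t
  ... | yes b/t≤a/t = ⊥-elim (<⇒≱ a<b (begin
          b                    ≡⟨ m≡m%n+[m/n]*n b t ⟩
          b % t + (b / t) * t  ≤⟨ +-mono-≤ (≤-reflexive (sym a≡b)) (*-monoˡ-≤ t b/t≤a/t) ⟩
          a % t + (a / t) * t  ≡⟨ m≡m%n+[m/n]*n a t ⟨
          a                    ∎))
    where open ≤-Reasoning
  ... | no b/t≰a/t = begin
          a + t                      ≡⟨ cong (_+ t) (m≡m%n+[m/n]*n a t) ⟩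
          a % t + (a / t) * t + t    ≡⟨ +-assoc (a % t) _ t ⟩
          a % t + ((a / t) * t + t)  ≡⟨ cong (a % t +_) (+-comm _ t) ⟩
          a % t + suc (a / t) * t    ≤⟨ +-monoʳ-≤ (a % t) (*-monoˡ-≤ t (≰⇒> b/t≰a/t)) ⟩
          a % t + (b / t) * t        ≡⟨ cong (_+ (b / t) * t) a≡b ⟩
          b % t + (b / t) * t        ≡⟨ m≡m%n+[m/n]*n b t ⟨
          b                          ∎
    where open ≤-Reasoning

  same-residue-pair : ∀ {a b} → a % t ≡ b % t → a < b → b < t + t + t → b ≡ a + t ⊎ (b ≡ a + t + t × a < t)
  same-residue-pair {a} {b} a≡b a<b b<3t with m≤n⇒m<n∨m≡n (same-residue-gap a≡b a<b)
  ... | inj₂ a+t≡b = inj₁ (sym a+t≡b)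
  ... | inj₁ a+t<b with m≤n⇒m<n∨m≡n (same-residue-gap (trans ([m+n]%n≡m%n a t) a≡b) a+t<b)
  ...   | inj₂ a+2t≡b =
    inj₂ (sym a+2t≡b , +-cancelʳ-< t a t (+-cancelʳ-< t (a + t) (t + t) (subst (_< t + t + t) (sym a+2t≡b) b<3t)))
  ...   | inj₁ a+2t<b = ⊥-elim (<⇒≱ b<3t (begin
          t + t + t      ≤⟨ +-monoˡ-≤ t (+-monoˡ-≤ t (m≤n+m t a)) ⟩
          a + t + t + t  ≤⟨ same-residue-gap (trans ([m+n]%n≡m%n (a + t) t) (trans ([m+n]%n≡m%n a t) a≡b)) a+2t<b ⟩
          b              ∎))
    where open ≤-Reasoning

module _ {n t : ℕ} .{{_ : NonZero t}} where

  residue : Fin n → Fin t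
  residue = colourBy (λ x → toℕ x % t) (λ x → m%n<n (toℕ x) t)

  ResidueClass : Fin t → Fin n → Set
  ResidueClass j x = residue x ≡ j

  same-class : ∀ {j x y} → ResidueClass j x → ResidueClass j y → toℕ x % t ≡ toℕ y % t
  same-class {x = x} {y} x∈j y∈j =
    colourBy-≡ (λ x → toℕ x % t) (λ x → m%n<n (toℕ x) t) {x} {y} (trans x∈j (sym y∈j))

module _ {n k t : ℕ} .{{_ : NonZero n}} .{{_ : NonZero t}}
         (n≤3t : n ≤ t + t + t) (2t≤n : t + t ≤ n) (t≤k : t ≤ k) where

  one-apart : ∀ {j u v} → ResidueClass j u → toℕ v ≡ toℕ u + t → Visible (C n) k (ResidueClass j) u v
  one-apart {j} {u} {v} u∈j v≡u+t =
    clockwise-Visible {M = ResidueClass j} u t (toℕ-injective (trans (rotate-< u u+t<n) (sym v≡u+t)))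
                      (>-nonZero⁻¹ t) 2t≤n t≤k avoids
    where
    u+t<n : toℕ u + t < n
    u+t<n = subst (_< n) v≡u+t (toℕ<n v)
    avoids : ∀ i → 0 < i → i < t → ¬ ResidueClass j (rotate u i)
    avoids i 0<i i<t x∈j = <⇒≱ i<t (+-cancelˡ-≤ (toℕ u) _ _
      (same-residue-gap t (trans (same-class u∈j x∈j) (cong (_% t) x≡u+i)) (m<m+n (toℕ u) 0<i)))
      where
      x≡u+i : toℕ (rotate u i) ≡ toℕ u + i
      x≡u+i = rotate-< u (<-trans (+-monoʳ-< (toℕ u) i<t) u+t<n)

  wrapping-arc-avoids : ∀ {j} {u v : Fin n} {L} → ResidueClass j u → ResidueClass j v → toℕ u < t → L ≤ t → L < n →
                        toℕ v + L ≡ toℕ u + n → ∀ i → 0 < i → i < L → ¬ ResidueClass j (rotate v i)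
  wrapping-arc-avoids {u = u} {v} {L} u∈j v∈j u<t L≤t L<n v+L≡u+n i 0<i i<L x∈j with toℕ v + i <? n
  ... | yes v+i<n = <⇒≱ (<-≤-trans i<L L≤t) (+-cancelˡ-≤ (toℕ v) _ _
        (same-residue-gap t (trans (same-class v∈j x∈j) (cong (_% t) (rotate-< v v+i<n))) (m<m+n (toℕ v) 0<i)))
  ... | no  v+i≮n = <⇒≱ u<t (≤-trans (m≤n+m t _) (same-residue-gap t (same-class x∈j u∈j) x<u))
    where
    open ≤-Reasoning
    x<u : toℕ (rotate v i) < toℕ u
    x<u = +-cancelʳ-< n _ _ (begin-strict
      toℕ (rotate v i) + n  ≡⟨ rotate-≥ v (≮⇒≥ v+i≮n) (<-trans i<L L<n) ⟩
      toℕ v + i             <⟨ +-monoʳ-< (toℕ v) i<L ⟩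
      toℕ v + L             ≡⟨ v+L≡u+n ⟩
      toℕ u + n             ∎)

  -- The short way from r + 2t back to r crosses the edge {n - 1, 0}.
  two-apart : ∀ {j u v} → ResidueClass j u → ResidueClass j v → toℕ v ≡ toℕ u + t + t → toℕ u < t →
              Visible (C n) k (ResidueClass j) v u
  two-apart {j} {u} {v} u∈j v∈j v≡u+2t u<t =
    clockwise-Visible {M = ResidueClass j} v L rotate≡u 0<L (≤-trans (+-mono-≤ L≤t L≤t) 2t≤n) (≤-trans L≤t t≤k)
                      (wrapping-arc-avoids u∈j v∈j u<t L≤t L<n v+L≡u+n)
    where
    open ≤-Reasoning
    L = n ∸ (t + t)
    2t+L≡n : t + t + L ≡ n
    2t+L≡n = m+[n∸m]≡n 2t≤n
    L≤t : L ≤ t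
    L≤t = +-cancelˡ-≤ (t + t) _ _ (subst (_≤ t + t + t) (sym 2t+L≡n) n≤3t)
    L<n : L < n
    L<n = <-≤-trans (≤-<-trans L≤t (m<m+n t (>-nonZero⁻¹ t))) 2t≤n
    v+L≡u+n : toℕ v + L ≡ toℕ u + n
    v+L≡u+n = begin-equality
      toℕ v + L            ≡⟨ cong (_+ L) v≡u+2t ⟩
      toℕ u + t + t + L    ≡⟨ cong (_+ L) (+-assoc (toℕ u) t t) ⟩
      toℕ u + (t + t) + L  ≡⟨ +-assoc (toℕ u) (t + t) L ⟩
      toℕ u + (t + t + L)  ≡⟨ cong (toℕ u +_) 2t+L≡n ⟩
      toℕ u + n            ∎
    0<L : 0 < L
    0<L = <-≤-trans (s≤s z≤n) (+-cancelʳ-< n _ _ (begin-strict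
      toℕ u + n  ≡⟨ v+L≡u+n ⟨
      toℕ v + L  <⟨ +-monoˡ-< L (toℕ<n v) ⟩
      n + L      ≡⟨ +-comm n L ⟩
      L + n      ∎))
    rotate≡u : rotate v L ≡ u
    rotate≡u = toℕ-injective (+-cancelʳ-≡ n _ _
      (trans (rotate-≥ v (subst (n ≤_) (sym v+L≡u+n) (m≤n+m n (toℕ u))) L<n) v+L≡u+n))

  residueColouring : KMVColouring (C n) k t
  residueColouring = residue , λ j → ordered⇒IsKDistMV C-symmetric (pairs j)
    where
    pairs : ∀ j u v → ResidueClass j u → ResidueClass j v → u Fin.< v →
            Visible (C n) k (ResidueClass j) u v ⊎ Visible (C n) k (ResidueClass j) v u
    pairs j u v u∈j v∈j u<v with same-residue-pair t (same-class u∈j v∈j) u<v (<-≤-trans (toℕ<n v) n≤3t)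
    ... | inj₁ v≡u+t          = inj₁ (one-apart u∈j v≡u+t)
    ... | inj₂ (v≡u+2t , u<t) = inj₂ (two-apart u∈j v∈j v≡u+2t u<t)

-- (n + e) / suc e is ⌈n / (e + 1)⌉; ⌈ n /2⌉' and ⌈ n /3⌉' are the cases e = 1 and e = 2.
module _ (e : ℕ) where

  ⌈/⌉-cover : ∀ n → n ≤ ((n + e) / suc e) * suc e
  ⌈/⌉-cover n = +-cancelʳ-≤ e _ _ (begin
    n + e                                          ≡⟨ m≡m%n+[m/n]*n (n + e) (suc e) ⟩
    (n + e) % suc e + ((n + e) / suc e) * suc e    ≤⟨ +-monoˡ-≤ _ (s≤s⁻¹ (m%n<n (n + e) (suc e))) ⟩
    e + ((n + e) / suc e) * suc e                  ≡⟨ +-comm e _ ⟩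
    ((n + e) / suc e) * suc e + e                  ∎)
    where open ≤-Reasoning

  ⌈/⌉-least : ∀ {n t} → n ≤ t * suc e → (n + e) / suc e ≤ t
  ⌈/⌉-least {n} {t} n≤t*d = s≤s⁻¹ (m<n*o⇒m/o<n (begin-strict
    n + e          <⟨ n<1+n (n + e) ⟩
    suc (n + e)    ≡⟨ cong suc (+-comm n e) ⟩
    suc e + n      ≤⟨ +-monoʳ-≤ (suc e) n≤t*d ⟩
    suc t * suc e  ∎))
    where open ≤-Reasoning

⌈/3⌉-double-≤ : ∀ n → 3 ≤ n → ⌈ n /3⌉' + ⌈ n /3⌉' ≤ n
⌈/3⌉-double-≤ n 3≤n = ≮⇒≥ λ n<2t → <⇒≱ (≤-trans (s≤s (s≤s z≤n)) 3≤n) (n≤1 n<2t)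
  where
  open ≤-Reasoning
  t = ⌈ n /3⌉'
  expand : ∀ n → n + n + (n + 3) ≡ suc n * 3
  expand = solve-∀
  collect : ∀ n → n + 2 + (n + 2) ≡ n + n + 4
  collect = solve-∀
  n≤1 : n < t + t → n ≤ 1
  n≤1 n<2t = +-cancelʳ-≤ 3 n 1 (+-cancelˡ-≤ (n + n) _ _ (begin
    n + n + (n + 3)  ≡⟨ expand n ⟩
    suc n * 3        ≤⟨ *-monoˡ-≤ 3 n<2t ⟩
    (t + t) * 3      ≡⟨ *-distribʳ-+ 3 t t ⟩
    t * 3 + t * 3    ≤⟨ +-mono-≤ (m/n*n≤m (n + 2) 3) (m/n*n≤m (n + 2) 3) ⟩
    n + 2 + (n + 2)  ≡⟨ collect n ⟩
    n + n + 4        ∎))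

C-small-colouring : ∀ {n k} → 3 ≤ n → n ≤ 3 * k → KMVColouring (C n) k ⌈ n /3⌉'
C-small-colouring {n} {k} 3≤n n≤3k = residueColouring {{n≢0}} {{t≢0}} n≤3t (⌈/3⌉-double-≤ n 3≤n) t≤k
  where
  t = ⌈ n /3⌉'
  n≢0 : NonZero n
  n≢0 = >-nonZero (<-≤-trans (s≤s z≤n) 3≤n)
  t≢0 : NonZero t
  t≢0 = >-nonZero (m≥n⇒m/n>0 (≤-trans 3≤n (m≤m+n n 2)))
  *3≡ : ∀ t → t * 3 ≡ t + t + t
  *3≡ = solve-∀
  n≤3t : n ≤ t + t + t
  n≤3t = ≤-trans (⌈/⌉-cover 2 n) (≤-reflexive (*3≡ t))
  t≤k : t ≤ k
  t≤k = ⌈/⌉-least 2 (≤-trans n≤3k (≤-reflexive (*-comm 3 k)))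

proposition2p4 : (k : ℕ) → 1 ≤ k →
    ((n : ℕ) → 1 ≤ n → ChiMuK≡ (P n) k ⌈ n /2⌉')
    × ((n : ℕ) → 3 ≤ n →
         (n ≤ 3 * k → ChiMuK≡ (C n) k ⌈ n /3⌉')
         × (n > 3 * k → ChiMuK≡ (C n) k ⌈ n /2⌉'))
proposition2p4 k 1≤k = path , λ n 3≤n → small-cycle n 3≤n , large-cycle n
  where
  path : (n : ℕ) → 1 ≤ n → ChiMuK≡ (P n) k ⌈ n /2⌉'
  path n _ = halvesColouring (P n) k _ P-symmetric inj₁ 1≤k (⌈/⌉-cover 1 n) ,
             λ t colouring → ⌈/⌉-least 1 (P-lower-bound colouring)
  small-cycle : (n : ℕ) → 3 ≤ n → n ≤ 3 * k → ChiMuK≡ (C n) k ⌈ n /3⌉'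
  small-cycle n 3≤n n≤3k = C-small-colouring 3≤n n≤3k ,
                           λ t colouring → ⌈/⌉-least 2 (C-lower-bound colouring)
  large-cycle : (n : ℕ) → n > 3 * k → ChiMuK≡ (C n) k ⌈ n /2⌉'
  large-cycle n 3k<n = halvesColouring (C n) k _ C-symmetric inj₁ 1≤k (⌈/⌉-cover 1 n) ,
                       λ t colouring → ⌈/⌉-least 1 (C-large-lower-bound colouring 3k<n)
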